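{- Let $k\ge 2$ and $G=\Theta(2,2,2k)$ with end vertices $u$ and $v$. If $L$ is a $3$-assignment for $G$ with $L(u)\ne L(v)$, then $P(G,L)\ge P(G,3)$.
   Context: $\Theta(l_1,l_2,l_3)$ is the graph of two end vertices joined by three internally disjoint paths of lengths $l_1,l_2,l_3$. A $3$-assignment $L$ gives each vertex a set of $3$ colors; $P(G,L)$ is the number of proper colorings $f$ of $G$ with $f(w)\in L(w)$ for all $w$; $P(G,m)$ is the chromatic polynomial. -}

module Defs where

open import Data.Nat using (ℕ; zero; suc; _+_; _∸_; _<_)
open import Data.Nat.Properties using (_≟_)
open import Data.List using (List; []; _∷_; [_]; map; concatMap; upTo; length; filter; _++_)
open import Data.List.Relation.Unary.All using (All; all?)
open import Data.List.Relation.Unary.Unique.Propositional using (Unique)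
open import Data.List.Membership.Propositional using (_∈_)
open import Data.Maybe using (Maybe; just; nothing)
open import Data.Maybe.Properties using (≡-dec)
open import Data.Product using (_×_; _,_; proj₁; proj₂)
open import Relation.Binary.PropositionalEquality using (_≡_; _≢_)
open import Relation.Nullary using (¬_; Dec; ¬?)

-- A (finite, simple) graph on vertex set {0, …, n-1} given by its edge list.
record Graph : Set where
  field
    size  : ℕ
    edges : List (ℕ × ℕ)
open Graph public

pathEdges : ℕ → ℕ → List ℕ → List (ℕ × ℕ)
pathEdges x y []       = [ (x , y) ]
pathEdges x y (w ∷ ws) = (x , w) ∷ pathEdges w y ws

range : ℕ → ℕ → List ℕ
range start len = map (start +_) (upTo len)

-- Θ(l₁,l₂,l₃) (lengths ≥ 1): end vertices u = 0 and v = 1; the internal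
-- vertices of the i-th path are numbered consecutively afterwards.
Theta : ℕ → ℕ → ℕ → Graph
Theta l₁ l₂ l₃ = record
  { size  = 2 + (l₁ ∸ 1) + (l₂ ∸ 1) + (l₃ ∸ 1)
  ; edges = pathEdges 0 1 (range 2 (l₁ ∸ 1))
         ++ pathEdges 0 1 (range (2 + (l₁ ∸ 1)) (l₂ ∸ 1))
         ++ pathEdges 0 1 (range (2 + (l₁ ∸ 1) + (l₂ ∸ 1)) (l₃ ∸ 1)) }

θu θv : ℕ
θu = 0
θv = 1

ListAssignment : Set
ListAssignment = ℕ → List ℕ

-- L is an m-assignment for G: each vertex gets a set of exactly m colours
-- (a duplicate-free list of length m).
IsAssignment : ℕ → Graph → ListAssignment → Set
IsAssignment m G L = ∀ w → w < size G → Unique (L w) × length (L w) ≡ m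

SameSet : List ℕ → List ℕ → Set
SameSet A B = (∀ c → c ∈ A → c ∈ B) × (∀ c → c ∈ B → c ∈ A)

-- colour of vertex i under colouring c (list of colours of vertices 0 … n-1)
colourAt : List ℕ → ℕ → Maybe ℕ
colourAt []       _       = nothing
colourAt (x ∷ _)  zero    = just x
colourAt (_ ∷ xs) (suc i) = colourAt xs i

choicesFrom : ListAssignment → ℕ → ℕ → List (List ℕ)
choicesFrom L i zero    = [ [] ]
choicesFrom L i (suc m) = concatMap (λ c → map (c ∷_) (choicesFrom L (suc i) m)) (L i)

Proper : Graph → List ℕ → Set
Proper G c = All (λ e → colourAt c (proj₁ e) ≢ colourAt c (proj₂ e)) (edges G)

proper? : (G : Graph) → (c : List ℕ) → Dec (Proper G c)
proper? G c = all? (λ e → ¬? (≡-dec _≟_ (colourAt c (proj₁ e)) (colourAt c (proj₂ e)))) (edges G)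

P : Graph → ListAssignment → ℕ
P G L = length (filter (proper? G) (choicesFrom L 0 (size G)))

Pchrom : Graph → ℕ → ℕ
Pchrom G m = P G (λ _ → upTo m)

private
  open import Relation.Binary.PropositionalEquality using (refl)
  t1 : size (Theta 2 2 4) ≡ 7
  t1 = refl
  -- Θ(2,2,2) = K_{2,3}: P(K_{2,3},3) = 3·2^3 + 6·1 = 30
  t2 : Pchrom (Theta 2 2 2) 3 ≡ 30
  t2 = refl

{-# OPTIONS --safe #-}
module Submission where

-- Colour u, v, the middle vertices x, y of the two short paths and the long path
-- separately:  P(G, L) = Σ_{c ∈ L(u), d ∈ L(v)} w(c, d) N(c, d),  where
-- w(c, d) = |L(x) ∖ {c, d}| · |L(y) ∖ {c, d}| and N(c, d) counts the L-colourings of the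
-- long path (length n = 2k) whose ends are coloured c and d.  Each N(c, d) is at least
-- q = 2^(n−2), and for fixed c the N(c, d), d ∈ L(v), add up to at least 4q; hence row c
-- contributes at least q (Σ_d w(c, d) + min_d w(c, d)).  These weights only depend on
-- which colours of L(u) and L(v) coincide and which of them lie in L(x) and L(y), and an
-- exhaustive check of all such Boolean patterns shows that the rows add up to at least 26
-- when L(u) ≠ L(v); so P(G, L) ≥ 26q.  With three colours the same decomposition gives
-- P(G, 3) = 12s + 6t, where s + 2t = 4q and s ≤ t + 1, so P(G, 3) ≤ 24q + 6 ≤ 26q.

open import Defs
open import Data.Bool using (Bool; true; false; _∧_; _∨_; not; T; _xor_; if_then_else_)
open import Data.Bool.ListAction using (and; or; any; all)
open import Data.Bool.Properties using (T-∧; T-≡; T?; ∧-identityʳ; ∧-zeroʳ; xor-same)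
open import Data.Empty using (⊥; ⊥-elim)
open import Data.List using (List; []; _∷_; map; concatMap; upTo; applyUpTo; length; filter; filterᵇ; _++_)
open import Data.List.Extrema.Nat using (min; min≤⊤; min≤xs)
open import Data.List.Membership.Propositional using (_∈_)
open import Data.List.Membership.Propositional.Properties using (∈-filter⁻; ∈-upTo⁻)
open import Data.List.Properties using (map-applyUpTo; map-cong)
open import Data.List.Relation.Unary.All as All using (All; []; _∷_; all?)
open import Data.List.Relation.Unary.All.Properties using (map⁻; all⁺; all⁻)
open import Data.List.Relation.Unary.AllPairs using ([]; _∷_)
open import Data.List.Relation.Unary.Any as Any using (here; there)
open import Data.List.Relation.Unary.Any.Properties using (any⁺; any⁻)
open import Data.List.Relation.Unary.Unique.Propositional using (Unique)
import Data.List.Relation.Unary.Unique.Propositional.Properties as Unique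
open import Data.Maybe using (just)
open import Data.Maybe.Properties using (≡-dec)
open import Data.Nat using (ℕ; zero; suc; _+_; _*_; _∸_; _^_; _≡ᵇ_; _≤ᵇ_; _≤_; _<_; z≤n; s≤s)
open import Data.Nat.Properties
open import Data.Nat.Tactic.RingSolver using (solve-∀)
open import Algebra.Properties.CommutativeSemigroup +-commutativeSemigroup using (interchange)
open import Data.Product using (_×_; _,_; proj₁; proj₂; ∃-syntax)
open import Data.Vec using (Vec; []; _∷_; zipWith; transpose; toList)
import Data.Vec as Vec
open import Function using (id; _∘_)
open import Function.Bundles using (Equivalence)
open import Relation.Binary.PropositionalEquality
open import Relation.Nullary using (¬_; does; yes; no; ¬?)
open import Relation.Nullary.Decidable using (True; toWitness; dec-true; dec-false)
open import Relation.Unary using (Pred; Decidable)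

private
  variable
    A B : Set

∑ : List A → (A → ℕ) → ℕ
∑ []       f = 0
∑ (x ∷ xs) f = f x + ∑ xs f

∑-cong : (xs : List A) {f g : A → ℕ} → (∀ x → f x ≡ g x) → ∑ xs f ≡ ∑ xs g
∑-cong []       f≗g = refl
∑-cong (x ∷ xs) f≗g = cong₂ _+_ (f≗g x) (∑-cong xs f≗g)

∑-cong-∈ : (xs : List A) {f g : A → ℕ} → (∀ x → x ∈ xs → f x ≡ g x) → ∑ xs f ≡ ∑ xs g
∑-cong-∈ []       f≗g = refl
∑-cong-∈ (x ∷ xs) f≗g = cong₂ _+_ (f≗g x (here refl)) (∑-cong-∈ xs (λ y y∈xs → f≗g y (there y∈xs)))

∑-++ : (xs ys : List A) (f : A → ℕ) → ∑ (xs ++ ys) f ≡ ∑ xs f + ∑ ys f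
∑-++ []       ys f = refl
∑-++ (x ∷ xs) ys f = trans (cong (f x +_) (∑-++ xs ys f)) (sym (+-assoc (f x) _ _))

∑-map : (g : B → A) (xs : List B) (f : A → ℕ) → ∑ (map g xs) f ≡ ∑ xs (λ x → f (g x))
∑-map g []       f = refl
∑-map g (x ∷ xs) f = cong (f (g x) +_) (∑-map g xs f)

∑-concatMap : (g : B → List A) (xs : List B) (f : A → ℕ)
            → ∑ (concatMap g xs) f ≡ ∑ xs (λ x → ∑ (g x) f)
∑-concatMap g []       f = refl
∑-concatMap g (x ∷ xs) f = trans (∑-++ (g x) _ f) (cong (∑ (g x) f +_) (∑-concatMap g xs f))

∑-*ˡ : (xs : List A) (k : ℕ) (f : A → ℕ) → ∑ xs (λ x → k * f x) ≡ k * ∑ xs f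
∑-*ˡ []       k f = sym (*-zeroʳ k)
∑-*ˡ (x ∷ xs) k f = trans (cong (k * f x +_) (∑-*ˡ xs k f)) (sym (*-distribˡ-+ k (f x) _))

∑-*ʳ : (xs : List A) (k : ℕ) (f : A → ℕ) → ∑ xs (λ x → f x * k) ≡ ∑ xs f * k
∑-*ʳ []       k f = refl
∑-*ʳ (x ∷ xs) k f = trans (cong (f x * k +_) (∑-*ʳ xs k f)) (sym (*-distribʳ-+ k (f x) _))

∑-+ : (xs : List A) (f g : A → ℕ) → ∑ xs (λ x → f x + g x) ≡ ∑ xs f + ∑ xs g
∑-+ []       f g = refl
∑-+ (x ∷ xs) f g = trans (cong (f x + g x +_) (∑-+ xs f g)) (interchange (f x) (g x) _ _)

∑-mono : (xs : List A) {f g : A → ℕ} → (∀ x → f x ≤ g x) → ∑ xs f ≤ ∑ xs g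
∑-mono []       f≤g = z≤n
∑-mono (x ∷ xs) f≤g = +-mono-≤ (f≤g x) (∑-mono xs f≤g)

∑-zero : (xs : List A) → ∑ xs (λ _ → 0) ≡ 0
∑-zero []       = refl
∑-zero (x ∷ xs) = ∑-zero xs

∑-const-1 : (xs : List A) → ∑ xs (λ _ → 1) ≡ length xs
∑-const-1 []       = refl
∑-const-1 (x ∷ xs) = cong suc (∑-const-1 xs)

∑-swap : (xs : List A) (ys : List B) (f : A → B → ℕ)
       → ∑ xs (λ x → ∑ ys (f x)) ≡ ∑ ys (λ y → ∑ xs (λ x → f x y))
∑-swap []       ys f = sym (∑-zero ys)
∑-swap (x ∷ xs) ys f = trans (cong (∑ ys (f x) +_) (∑-swap xs ys f)) (sym (∑-+ ys (f x) _))

𝟙 : Bool → ℕ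
𝟙 true  = 1
𝟙 false = 0

𝟙≤1 : ∀ x → 𝟙 x ≤ 1
𝟙≤1 true  = s≤s z≤n
𝟙≤1 false = z≤n

𝟙-∧ : ∀ x y → 𝟙 (x ∧ y) ≡ 𝟙 x * 𝟙 y
𝟙-∧ true  y = sym (+-identityʳ (𝟙 y))
𝟙-∧ false y = refl

length-filter : ∀ {p} {P : Pred A p} (P? : Decidable P) (xs : List A)
              → length (filter P? xs) ≡ ∑ xs (λ x → 𝟙 (does (P? x)))
length-filter P? []       = refl
length-filter P? (x ∷ xs) with does (P? x)
... | true  = cong suc (length-filter P? xs)
... | false = length-filter P? xs

∑-filterᵇ : (g h : A → Bool) (xs : List A) → ∑ (filterᵇ g xs) (𝟙 ∘ h) ≡ ∑ xs (λ x → 𝟙 (g x ∧ h x))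
∑-filterᵇ g h []       = refl
∑-filterᵇ g h (x ∷ xs) with g x
... | true  = cong (𝟙 (h x) +_) (∑-filterᵇ g h xs)
... | false = ∑-filterᵇ g h xs

-- Decomposition of P(Θ(2,2,n), L)

neq : ℕ → ℕ → ℕ
neq a b = 𝟙 (not (a ≡ᵇ b))

chain : ℕ → List ℕ → ℕ → Bool
chain a []      b = not (a ≡ᵇ b)
chain a (z ∷ r) b = not (a ≡ᵇ z) ∧ chain z r b

-- L-colourings of a path whose m inner vertices are i, …, i + m − 1 and whose ends are
-- precoloured a and b.
walks : ListAssignment → ℕ → ℕ → ℕ → ℕ → ℕ
walks L i zero    a b = neq a b
walks L i (suc m) a b = ∑ (L i) λ z → neq a z * walks L (suc i) m z b

avoid : List ℕ → ℕ → ℕ → ℕ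
avoid X c d = ∑ X λ e → neq c e * neq e d

∑-choicesFrom : ∀ L i m (f : List ℕ → ℕ)
              → ∑ (choicesFrom L i (suc m)) f ≡ ∑ (L i) (λ c → ∑ (choicesFrom L (suc i) m) (λ r → f (c ∷ r)))
∑-choicesFrom L i m f =
  trans (∑-concatMap _ (L i) f) (∑-cong (L i) (λ c → ∑-map (c ∷_) (choicesFrom L (suc i) m) f))

∑-choicesFrom-cong : ∀ L i m {f g : List ℕ → ℕ} → (∀ r → length r ≡ m → f r ≡ g r)
                   → ∑ (choicesFrom L i m) f ≡ ∑ (choicesFrom L i m) g
∑-choicesFrom-cong L i zero    f≗g = cong (_+ 0) (f≗g [] refl)
∑-choicesFrom-cong L i (suc m) {f} {g} f≗g = begin
  ∑ (choicesFrom L i (suc m)) f                              ≡⟨ ∑-choicesFrom L i m f ⟩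
  ∑ (L i) (λ c → ∑ (choicesFrom L (suc i) m) (f ∘ (c ∷_)))  ≡⟨ ∑-cong (L i) (λ c → ∑-choicesFrom-cong L (suc i) m
                                                                   (λ r |r|≡m → f≗g (c ∷ r) (cong suc |r|≡m))) ⟩
  ∑ (L i) (λ c → ∑ (choicesFrom L (suc i) m) (g ∘ (c ∷_)))  ≡⟨ ∑-choicesFrom L i m g ⟨
  ∑ (choicesFrom L i (suc m)) g                              ∎
  where open ≡-Reasoning

∑-chain : ∀ L i m a b → ∑ (choicesFrom L i m) (λ r → 𝟙 (chain a r b)) ≡ walks L i m a b
∑-chain L i zero    a b = +-identityʳ (neq a b)
∑-chain L i (suc m) a b = trans (∑-choicesFrom L i m (λ r → 𝟙 (chain a r b))) (∑-cong (L i) λ z → begin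
  ∑ rs (λ r → 𝟙 (not (a ≡ᵇ z) ∧ chain z r b))  ≡⟨ ∑-cong rs (λ r → 𝟙-∧ (not (a ≡ᵇ z)) (chain z r b)) ⟩
  ∑ rs (λ r → neq a z * 𝟙 (chain z r b))       ≡⟨ ∑-*ˡ rs (neq a z) _ ⟩
  neq a z * ∑ rs (λ r → 𝟙 (chain z r b))       ≡⟨ cong (neq a z *_) (∑-chain L (suc i) m z b) ⟩
  neq a z * walks L (suc i) m z b               ∎)
  where
  open ≡-Reasoning
  rs = choicesFrom L (suc i) m

properEdges : List ℕ → List (ℕ × ℕ) → Bool
properEdges col es = does (all? (λ e → ¬? (≡-dec _≟_ (colourAt col (proj₁ e)) (colourAt col (proj₂ e)))) es)

properEdges-path : ∀ col r (f : ℕ → ℕ) x a b → colourAt col x ≡ just a → colourAt col 1 ≡ just b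
                 → (∀ j → colourAt col (f j) ≡ colourAt r j)
                 → properEdges col (pathEdges x 1 (applyUpTo f (length r))) ≡ chain a r b
properEdges-path col []      f x a b x↦a 1↦b f↦r rewrite x↦a | 1↦b = ∧-identityʳ (not (a ≡ᵇ b))
properEdges-path col (z ∷ r) f x a b x↦a 1↦b f↦r =
  cong₂ _∧_ (cong₂ (λ u v → not (does (≡-dec _≟_ u v))) x↦a (f↦r 0))
            (properEdges-path col r (f ∘ suc) (f 0) z b (f↦r 0) 1↦b (f↦r ∘ suc))

𝟙-proper-Θ₂₂ : ∀ n c d e f r → length r ≡ n ∸ 1
             → 𝟙 (does (proper? (Theta 2 2 n) (c ∷ d ∷ e ∷ f ∷ r)))
             ≡ (neq c e * neq e d) * ((neq c f * neq f d) * 𝟙 (chain c r d))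
𝟙-proper-Θ₂₂ n c d e f r |r|≡n-1 = begin
  𝟙 (x₁ ∧ x₂ ∧ x₃ ∧ x₄ ∧ properEdges col (pathEdges 0 1 (range 4 (n ∸ 1))))
    ≡⟨ cong (λ p → 𝟙 (x₁ ∧ x₂ ∧ x₃ ∧ x₄ ∧ p)) long-path ⟩
  𝟙 (x₁ ∧ x₂ ∧ x₃ ∧ x₄ ∧ chain c r d)
    ≡⟨ trans (𝟙-∧ x₁ _) (cong (𝟙 x₁ *_) (trans (𝟙-∧ x₂ _) (cong (𝟙 x₂ *_)
         (trans (𝟙-∧ x₃ _) (cong (𝟙 x₃ *_) (𝟙-∧ x₄ _)))))) ⟩
  𝟙 x₁ * (𝟙 x₂ * (𝟙 x₃ * (𝟙 x₄ * 𝟙 (chain c r d))))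
    ≡⟨ regroup (𝟙 x₁) (𝟙 x₂) (𝟙 x₃) (𝟙 x₄) _ ⟩
  (neq c e * neq e d) * ((neq c f * neq f d) * 𝟙 (chain c r d)) ∎
  where
  open ≡-Reasoning
  col = c ∷ d ∷ e ∷ f ∷ r
  x₁ = not (c ≡ᵇ e)
  x₂ = not (e ≡ᵇ d)
  x₃ = not (c ≡ᵇ f)
  x₄ = not (f ≡ᵇ d)
  long-path : properEdges col (pathEdges 0 1 (range 4 (n ∸ 1))) ≡ chain c r d
  long-path rewrite sym |r|≡n-1 | map-applyUpTo id (4 +_) (length r) =
    properEdges-path col r (4 +_) 0 c d refl refl (λ j → refl)
  regroup : ∀ a b c d w → a * (b * (c * (d * w))) ≡ a * b * (c * d * w)
  regroup = solve-∀

∑-long-path : ∀ n L c d e f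
  → ∑ (choicesFrom L 4 (n ∸ 1)) (λ r → 𝟙 (does (proper? (Theta 2 2 n) (c ∷ d ∷ e ∷ f ∷ r))))
  ≡ (neq c e * neq e d) * ((neq c f * neq f d) * walks L 4 (n ∸ 1) c d)
∑-long-path n L c d e f = begin
  ∑ rs (λ r → 𝟙 (does (proper? (Theta 2 2 n) (c ∷ d ∷ e ∷ f ∷ r))))
    ≡⟨ ∑-choicesFrom-cong L 4 (n ∸ 1) (𝟙-proper-Θ₂₂ n c d e f) ⟩
  ∑ rs (λ r → (neq c e * neq e d) * ((neq c f * neq f d) * 𝟙 (chain c r d)))
    ≡⟨ ∑-*ˡ rs (neq c e * neq e d) _ ⟩
  (neq c e * neq e d) * ∑ rs (λ r → (neq c f * neq f d) * 𝟙 (chain c r d))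
    ≡⟨ cong ((neq c e * neq e d) *_) (∑-*ˡ rs (neq c f * neq f d) _) ⟩
  (neq c e * neq e d) * ((neq c f * neq f d) * ∑ rs (λ r → 𝟙 (chain c r d)))
    ≡⟨ cong (λ W → (neq c e * neq e d) * ((neq c f * neq f d) * W)) (∑-chain L 4 (n ∸ 1) c d) ⟩
  (neq c e * neq e d) * ((neq c f * neq f d) * walks L 4 (n ∸ 1) c d) ∎
  where
  open ≡-Reasoning
  rs = choicesFrom L 4 (n ∸ 1)

∑²-avoid : ∀ X Y c d W → ∑ X (λ e → ∑ Y λ f → (neq c e * neq e d) * ((neq c f * neq f d) * W))
                        ≡ avoid X c d * avoid Y c d * W
∑²-avoid X Y c d W = begin
  ∑ X (λ e → ∑ Y λ f → (neq c e * neq e d) * ((neq c f * neq f d) * W))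
    ≡⟨ ∑-cong X (λ e → ∑-*ˡ Y (neq c e * neq e d) _) ⟩
  ∑ X (λ e → (neq c e * neq e d) * ∑ Y λ f → (neq c f * neq f d) * W)
    ≡⟨ ∑-*ʳ X (∑ Y λ f → (neq c f * neq f d) * W) _ ⟩
  avoid X c d * ∑ Y (λ f → (neq c f * neq f d) * W)
    ≡⟨ cong (avoid X c d *_) (∑-*ʳ Y W _) ⟩
  avoid X c d * (avoid Y c d * W)
    ≡⟨ *-assoc (avoid X c d) (avoid Y c d) W ⟨
  avoid X c d * avoid Y c d * W ∎
  where open ≡-Reasoning

P-Θ₂₂ : ∀ n L → P (Theta 2 2 n) L
      ≡ ∑ (L 0) λ c → ∑ (L 1) λ d → avoid (L 2) c d * avoid (L 3) c d * walks L 4 (n ∸ 1) c d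
P-Θ₂₂ n L = begin
  P (Theta 2 2 n) L
    ≡⟨ length-filter (proper? (Theta 2 2 n)) (choicesFrom L 0 (4 + m)) ⟩
  ∑ (choicesFrom L 0 (4 + m)) proper
    ≡⟨ ∑-choicesFrom L 0 (3 + m) proper ⟩
  ∑ (L 0) (λ c → ∑ (choicesFrom L 1 (3 + m)) λ r → proper (c ∷ r))
    ≡⟨ ∑-cong (L 0) (λ c → ∑-choicesFrom L 1 (2 + m) _) ⟩
  ∑ (L 0) (λ c → ∑ (L 1) λ d → ∑ (choicesFrom L 2 (2 + m)) λ r → proper (c ∷ d ∷ r))
    ≡⟨ ∑-cong (L 0) (λ c → ∑-cong (L 1) λ d → ∑-choicesFrom L 2 (1 + m) _) ⟩
  ∑ (L 0) (λ c → ∑ (L 1) λ d → ∑ (L 2) λ e → ∑ (choicesFrom L 3 (1 + m)) λ r → proper (c ∷ d ∷ e ∷ r))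
    ≡⟨ ∑-cong (L 0) (λ c → ∑-cong (L 1) λ d → ∑-cong (L 2) λ e → ∑-choicesFrom L 3 m _) ⟩
  ∑ (L 0) (λ c → ∑ (L 1) λ d → ∑ (L 2) λ e → ∑ (L 3) λ f → ∑ (choicesFrom L 4 m) λ r → proper (c ∷ d ∷ e ∷ f ∷ r))
    ≡⟨ ∑-cong (L 0) (λ c → ∑-cong (L 1) λ d → ∑-cong (L 2) λ e → ∑-cong (L 3) λ f → ∑-long-path n L c d e f) ⟩
  ∑ (L 0) (λ c → ∑ (L 1) λ d → ∑ (L 2) λ e → ∑ (L 3) λ f → (neq c e * neq e d) * ((neq c f * neq f d) * walks L 4 m c d))
    ≡⟨ ∑-cong (L 0) (λ c → ∑-cong (L 1) λ d → ∑²-avoid (L 2) (L 3) c d (walks L 4 m c d)) ⟩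
  ∑ (L 0) (λ c → ∑ (L 1) λ d → avoid (L 2) c d * avoid (L 3) c d * walks L 4 m c d) ∎
  where
  open ≡-Reasoning
  m = n ∸ 1
  proper : List ℕ → ℕ
  proper col = 𝟙 (does (proper? (Theta 2 2 n) col))

_∈ᵇ_ : ℕ → List ℕ → Bool
c ∈ᵇ X = any (_≡ᵇ c) X

Triple : List ℕ → Set
Triple X = Unique X × length X ≡ 3

≡ᵇ-sym : ∀ a b → (a ≡ᵇ b) ≡ (b ≡ᵇ a)
≡ᵇ-sym zero    zero    = refl
≡ᵇ-sym zero    (suc b) = refl
≡ᵇ-sym (suc a) zero    = refl
≡ᵇ-sym (suc a) (suc b) = ≡ᵇ-sym a b

∑-𝟙-≡ᵇ : ∀ c {X} → Unique X → ∑ X (λ e → 𝟙 (c ≡ᵇ e)) ≡ 𝟙 (c ∈ᵇ X)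
∑-𝟙-≡ᵇ c {[]}    []         = refl
∑-𝟙-≡ᵇ c {x ∷ X} (x∉X ∷ uX) with c ≟ x
... | yes refl rewrite dec-true (c ≟ c) refl = cong suc (absent x∉X)
  where
  absent : ∀ {Y} → All (c ≢_) Y → ∑ Y (λ e → 𝟙 (c ≡ᵇ e)) ≡ 0
  absent []          = refl
  absent (c≢y ∷ c∉Y) rewrite dec-false (c ≟ _) c≢y = absent c∉Y
... | no c≢x rewrite dec-false (c ≟ x) c≢x | dec-false (x ≟ c) (≢-sym c≢x) = ∑-𝟙-≡ᵇ c uX

∑-neq : ∀ c {X} → Triple X → ∑ X (neq c) + 𝟙 (c ∈ᵇ X) ≡ 3
∑-neq c {X} (uX , |X|≡3) = begin
  ∑ X (neq c) + 𝟙 (c ∈ᵇ X)                ≡⟨ cong (∑ X (neq c) +_) (∑-𝟙-≡ᵇ c uX) ⟨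
  ∑ X (neq c) + ∑ X (λ e → 𝟙 (c ≡ᵇ e))    ≡⟨ ∑-+ X (neq c) _ ⟨
  ∑ X (λ e → neq c e + 𝟙 (c ≡ᵇ e))        ≡⟨ ∑-cong X (λ e → 𝟙-not+𝟙 (c ≡ᵇ e)) ⟩
  ∑ X (λ _ → 1)                            ≡⟨ trans (∑-const-1 X) |X|≡3 ⟩
  3                                        ∎
  where
  open ≡-Reasoning
  𝟙-not+𝟙 : ∀ x → 𝟙 (not x) + 𝟙 x ≡ 1
  𝟙-not+𝟙 true  = refl
  𝟙-not+𝟙 false = refl

avoid-diagonal : ∀ X c → avoid X c c ≡ ∑ X (neq c)
avoid-diagonal X c = ∑-cong X λ e →
  trans (cong (λ b → neq c e * 𝟙 (not b)) (≡ᵇ-sym e c)) (𝟙-idem (not (c ≡ᵇ e)))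
  where
  𝟙-idem : ∀ x → 𝟙 x * 𝟙 x ≡ 𝟙 x
  𝟙-idem true  = refl
  𝟙-idem false = refl

avoid+∈ᵇ : ∀ {c d X} → c ≢ d → Triple X → avoid X c d + (𝟙 (c ∈ᵇ X) + 𝟙 (d ∈ᵇ X)) ≡ 3
avoid+∈ᵇ {c} {d} {X} c≢d (uX , |X|≡3) = begin
  avoid X c d + (𝟙 (c ∈ᵇ X) + 𝟙 (d ∈ᵇ X))
    ≡⟨ cong₂ (λ u v → avoid X c d + (u + v)) (∑-𝟙-≡ᵇ c uX) (∑-𝟙-≡ᵇ d uX) ⟨
  avoid X c d + (∑ X (λ e → 𝟙 (c ≡ᵇ e)) + ∑ X (λ e → 𝟙 (d ≡ᵇ e)))
    ≡⟨ cong (avoid X c d +_) (∑-+ X _ _) ⟨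
  avoid X c d + ∑ X (λ e → 𝟙 (c ≡ᵇ e) + 𝟙 (d ≡ᵇ e))
    ≡⟨ ∑-+ X _ _ ⟨
  ∑ X (λ e → neq c e * neq e d + (𝟙 (c ≡ᵇ e) + 𝟙 (d ≡ᵇ e)))
    ≡⟨ ∑-cong X cell ⟩
  ∑ X (λ _ → 1)
    ≡⟨ trans (∑-const-1 X) |X|≡3 ⟩
  3 ∎
  where
  open ≡-Reasoning
  at-most-one : ∀ p q → (T p → T q → ⊥) → 𝟙 (not p) * 𝟙 (not q) + (𝟙 p + 𝟙 q) ≡ 1
  at-most-one true  true  ¬both = ⊥-elim (¬both _ _)
  at-most-one true  false _     = refl
  at-most-one false true  _     = refl
  at-most-one false false _     = refl
  cell : ∀ e → neq c e * neq e d + (𝟙 (c ≡ᵇ e) + 𝟙 (d ≡ᵇ e)) ≡ 1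
  cell e rewrite ≡ᵇ-sym e d = at-most-one (c ≡ᵇ e) (d ≡ᵇ e)
    (λ c≡e d≡e → c≢d (trans (≡ᵇ⇒≡ c e c≡e) (sym (≡ᵇ⇒≡ d e d≡e))))

-- |X ∖ {c, d}| in terms of c = d, c ∈ X and d ∈ X.
α : Bool → Bool → Bool → ℕ
α true  m _  = 3 ∸ 𝟙 m
α false m m′ = 3 ∸ (𝟙 m + 𝟙 m′)

α-pos : ∀ e m m′ → 1 ≤ α e m m′
α-pos true  true  _     = s≤s z≤n
α-pos true  false _     = s≤s z≤n
α-pos false true  true  = s≤s z≤n
α-pos false true  false = s≤s z≤n
α-pos false false true  = s≤s z≤n
α-pos false false false = s≤s z≤n

avoid-α : ∀ c d {X} → Triple X → avoid X c d ≡ α (c ≡ᵇ d) (c ∈ᵇ X) (d ∈ᵇ X)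
avoid-α c d {X} tX with c ≟ d
... | yes refl rewrite dec-true (c ≟ c) refl = begin
  avoid X c c                              ≡⟨ avoid-diagonal X c ⟩
  ∑ X (neq c)                              ≡⟨ m+n∸n≡m (∑ X (neq c)) (𝟙 (c ∈ᵇ X)) ⟨
  ∑ X (neq c) + 𝟙 (c ∈ᵇ X) ∸ 𝟙 (c ∈ᵇ X)    ≡⟨ cong (_∸ 𝟙 (c ∈ᵇ X)) (∑-neq c tX) ⟩
  3 ∸ 𝟙 (c ∈ᵇ X)                           ∎
  where open ≡-Reasoning
... | no c≢d rewrite dec-false (c ≟ d) c≢d = begin
  avoid X c d                                 ≡⟨ m+n∸n≡m (avoid X c d) (𝟙 (c ∈ᵇ X) + 𝟙 (d ∈ᵇ X)) ⟨
  avoid X c d + (𝟙 (c ∈ᵇ X) + 𝟙 (d ∈ᵇ X)) ∸ (𝟙 (c ∈ᵇ X) + 𝟙 (d ∈ᵇ X))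
                                              ≡⟨ cong (_∸ (𝟙 (c ∈ᵇ X) + 𝟙 (d ∈ᵇ X))) (avoid+∈ᵇ c≢d tX) ⟩
  3 ∸ (𝟙 (c ∈ᵇ X) + 𝟙 (d ∈ᵇ X))               ∎
  where open ≡-Reasoning

∑-neq-≥ : ∀ a {X k} (f : ℕ → ℕ) → Triple X → (∀ z → k ≤ f z) → 2 * k ≤ ∑ X (λ z → neq a z * f z)
∑-neq-≥ a {X} {k} f tX k≤f = begin
  2 * k                          ≤⟨ *-monoˡ-≤ k 2≤∑neq ⟩
  ∑ X (neq a) * k                ≡⟨ ∑-*ʳ X k (neq a) ⟨
  ∑ X (λ z → neq a z * k)        ≤⟨ ∑-mono X (λ z → *-monoʳ-≤ (neq a z) (k≤f z)) ⟩
  ∑ X (λ z → neq a z * f z)      ∎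
  where
  open ≤-Reasoning
  2≤∑neq : 2 ≤ ∑ X (neq a)
  2≤∑neq = +-cancelʳ-≤ 1 2 (∑ X (neq a)) (begin
    2 + 1                        ≡⟨ ∑-neq a tX ⟨
    ∑ X (neq a) + 𝟙 (a ∈ᵇ X)     ≤⟨ +-monoʳ-≤ (∑ X (neq a)) (𝟙≤1 (a ∈ᵇ X)) ⟩
    ∑ X (neq a) + 1              ∎)

-- Lower bounds for path colourings

TriplesBelow : ListAssignment → ℕ → Set
TriplesBelow L k = ∀ j → j < k → Triple (L j)

walks-≥ : ∀ L i m a b → TriplesBelow L (i + suc m) → 2 ^ m ≤ walks L i (suc m) a b
walks-≥ L i zero    a b tL =
  subst (1 ≤_) (sym (avoid-α a b (tL i (m<m+n i (s≤s z≤n))))) (α-pos (a ≡ᵇ b) (a ∈ᵇ L i) (b ∈ᵇ L i))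
walks-≥ L i (suc m) a b tL =
  ∑-neq-≥ a (λ z → walks L (suc i) (suc m) z b) (tL i (m<m+n i (s≤s z≤n)))
    (λ z → walks-≥ L (suc i) m z b (subst (TriplesBelow L) (+-suc i (suc m)) tL))

∑-walks-≥ : ∀ L i m a {B} → Triple B → TriplesBelow L (i + m) → 2 ^ suc m ≤ ∑ B (walks L i m a)
∑-walks-≥ L i zero    a {B} tB tL =
  subst (2 ≤_) (∑-cong B (λ d → *-identityʳ (neq a d))) (∑-neq-≥ a (λ _ → 1) tB (λ _ → ≤-refl))
∑-walks-≥ L i (suc m) a {B} tB tL = begin
  2 * 2 ^ suc m                                                 ≤⟨ ∑-neq-≥ a (λ z → ∑ B (walks L (suc i) m z))
                                                                     (tL i (m<m+n i (s≤s z≤n))) ∑B-walks-≥ ⟩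
  ∑ (L i) (λ z → neq a z * ∑ B (walks L (suc i) m z))           ≡⟨ ∑-cong (L i) (λ z → ∑-*ˡ B (neq a z) _) ⟨
  ∑ (L i) (λ z → ∑ B (λ d → neq a z * walks L (suc i) m z d))   ≡⟨ ∑-swap (L i) B _ ⟩
  ∑ B (walks L i (suc m) a)                                     ∎
  where
  open ≤-Reasoning
  ∑B-walks-≥ : ∀ z → 2 ^ suc m ≤ ∑ B (walks L (suc i) m z)
  ∑B-walks-≥ z = ∑-walks-≥ L (suc i) m z tB (subst (TriplesBelow L) (+-suc i m) tL)

cross-≤ : ∀ {μ w q n} → μ ≤ w → q ≤ n → q * w + μ * n ≤ w * n + μ * q
cross-≤ {μ} {q = q} μ≤w q≤n with m≤n⇒∃[o]m+o≡n μ≤w | m≤n⇒∃[o]m+o≡n q≤n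
... | a , refl | b , refl =
  subst (q * (μ + a) + μ * (q + b) ≤_) (sym (expand μ a q b)) (m≤m+n _ (a * b))
  where
  expand : ∀ μ a q b → (μ + a) * (q + b) + μ * q ≡ q * (μ + a) + μ * (q + b) + a * b
  expand = solve-∀

∑-cross-≤ : ∀ (xs : List A) (w n : A → ℕ) {μ q} → All (λ x → μ ≤ w x) xs → (∀ x → q ≤ n x)
          → q * ∑ xs w + μ * ∑ xs n ≤ ∑ xs (λ x → w x * n x) + μ * (q * length xs)
∑-cross-≤ []       w n {μ} {q} []           q≤n =
  ≤-reflexive (cong₂ (λ a b → a + μ * b) (*-zeroʳ q) (sym (*-zeroʳ q)))
∑-cross-≤ (x ∷ xs) w n {μ} {q} (μ≤wx ∷ μ≤w) q≤n = begin
  q * (w x + ∑ xs w) + μ * (n x + ∑ xs n)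
    ≡⟨ split q μ (w x) (n x) _ _ ⟩
  (q * w x + μ * n x) + (q * ∑ xs w + μ * ∑ xs n)
    ≤⟨ +-mono-≤ (cross-≤ μ≤wx (q≤n x)) (∑-cross-≤ xs w n μ≤w q≤n) ⟩
  (w x * n x + μ * q) + (∑ xs (λ y → w y * n y) + μ * (q * length xs))
    ≡⟨ merge μ q (w x * n x) _ (length xs) ⟩
  w x * n x + ∑ xs (λ y → w y * n y) + μ * (q * suc (length xs)) ∎
  where
  open ≤-Reasoning
  split : ∀ q μ a b s t → q * (a + s) + μ * (b + t) ≡ (q * a + μ * b) + (q * s + μ * t)
  split = solve-∀
  merge : ∀ μ q p r l → (p + μ * q) + (r + μ * (q * l)) ≡ p + r + μ * (q * suc l)
  merge = solve-∀

rowScore : List ℕ → ℕ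
rowScore []       = 0
rowScore (w ∷ ws) = ∑ (w ∷ ws) id + min w ws

rowScore-≤ : ∀ (xs : List A) (w n : A → ℕ) {q} → (∀ x → q ≤ n x) → suc (length xs) * q ≤ ∑ xs n
           → q * rowScore (map w xs) ≤ ∑ xs (λ x → w x * n x)
rowScore-≤ []       w n {q} q≤n _  = ≤-reflexive (*-zeroʳ q)
rowScore-≤ (x ∷ xs) w n {q} q≤n ∑n = +-cancelʳ-≤ (μ * (q * ℓ)) _ _ (begin
  q * (∑ (map w (x ∷ xs)) id + μ) + μ * (q * ℓ)   ≡⟨ cong (λ s → q * (s + μ) + μ * (q * ℓ)) (∑-map w (x ∷ xs) id) ⟩
  q * (∑ (x ∷ xs) w + μ) + μ * (q * ℓ)            ≡⟨ regroup q μ (∑ (x ∷ xs) w) ℓ ⟩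
  q * ∑ (x ∷ xs) w + μ * (suc ℓ * q)              ≤⟨ +-monoʳ-≤ (q * ∑ (x ∷ xs) w) (*-monoʳ-≤ μ ∑n) ⟩
  q * ∑ (x ∷ xs) w + μ * ∑ (x ∷ xs) n             ≤⟨ ∑-cross-≤ (x ∷ xs) w n μ≤w q≤n ⟩
  ∑ (x ∷ xs) (λ y → w y * n y) + μ * (q * ℓ)      ∎)
  where
  open ≤-Reasoning
  μ = min (w x) (map w xs)
  ℓ = length (x ∷ xs)
  μ≤w : All (λ y → μ ≤ w y) (x ∷ xs)
  μ≤w = min≤⊤ (w x) (map w xs) ∷ map⁻ (min≤xs (w x) (map w xs))
  regroup : ∀ q μ s l → q * (s + μ) + μ * (q * l) ≡ q * s + μ * (suc l * q)
  regroup = solve-∀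

∑-rowScore-≤ : ∀ (A B : List ℕ) (w N : ℕ → ℕ → ℕ) {q} → (∀ c d → q ≤ N c d)
             → (∀ c → suc (length B) * q ≤ ∑ B (N c))
             → q * ∑ A (λ c → rowScore (map (w c) B)) ≤ ∑ A (λ c → ∑ B (λ d → w c d * N c d))
∑-rowScore-≤ A B w N {q} q≤N ∑N≥ = begin
  q * ∑ A (λ c → rowScore (map (w c) B))   ≡⟨ ∑-*ˡ A q _ ⟨
  ∑ A (λ c → q * rowScore (map (w c) B))   ≤⟨ ∑-mono A (λ c → rowScore-≤ B (w c) (N c) (q≤N c) (∑N≥ c)) ⟩
  ∑ A (λ c → ∑ B (λ d → w c d * N c d))    ∎
  where open ≤-Reasoning

-- Boolean shadows

record Exhaustible (A : Set) : Set where
  field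
    every       : (A → Bool) → Bool
    every-sound : ∀ p → every p ≡ true → ∀ x → p x ≡ true
open Exhaustible

∧-≡-true : ∀ {x y} → x ∧ y ≡ true → x ≡ true × y ≡ true
∧-≡-true {true} y≡true = refl , y≡true

Bool-exhaustible : Exhaustible Bool
Bool-exhaustible .every p = p true ∧ p false
Bool-exhaustible .every-sound p all-p true  = proj₁ (∧-≡-true all-p)
Bool-exhaustible .every-sound p all-p false = proj₂ (∧-≡-true all-p)

Vec-exhaustible : Exhaustible A → ∀ n → Exhaustible (Vec A n)
Vec-exhaustible 𝔸 zero    .every p = p []
Vec-exhaustible 𝔸 zero    .every-sound p all-p [] = all-p
Vec-exhaustible 𝔸 (suc n) .every p = every 𝔸 λ x → every (Vec-exhaustible 𝔸 n) λ xs → p (x ∷ xs)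
Vec-exhaustible 𝔸 (suc n) .every-sound p all-p (x ∷ xs) =
  every-sound (Vec-exhaustible 𝔸 n) _ (every-sound 𝔸 _ all-p x) xs

every² : Exhaustible A → (A → A → Bool) → Bool
every² 𝔸 p = every 𝔸 λ x → every 𝔸 λ y → p x y

every²-sound : (𝔸 : Exhaustible A) (p : A → A → Bool) → every² 𝔸 p ≡ true → ∀ x y → p x y ≡ true
every²-sound 𝔸 p all-p x = every-sound 𝔸 (p x) (every-sound 𝔸 _ all-p x)

_⇒_ : Bool → Bool → Bool
x ⇒ y = not x ∨ y

⇒-elim : ∀ {x y} → (x ⇒ y) ≡ true → x ≡ true → y ≡ true
⇒-elim y≡true refl = y≡true

anyᵛ allᵛ : ∀ {n} → Vec Bool n → Bool
anyᵛ = or ∘ toList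
allᵛ = and ∘ toList

countᵛ : ∀ {n} → Vec Bool n → ℕ
countᵛ v = ∑ (toList v) 𝟙

-- The shadow of colour triples c₀c₁c₂ = L(u) and d₀d₁d₂ = L(v) on a list X of colours:
-- the pattern E with E i j = (cᵢ = dⱼ) and the memberships a i = (cᵢ ∈ X), b j = (dⱼ ∈ X).
-- A pattern coming from lists without repetitions has at most one coincidence per row;
-- L(u) ≠ L(v) means that some row or some column has none.  Memberships must agree along
-- coincidences, and X contains at most 3 of the distinct colours c₀, c₁, c₂ and dⱼ ∉ L(u).
Pattern : Set
Pattern = Vec (Vec Bool 3) 3

Membership : Set
Membership = Vec Bool 3

perfect : Pattern → Bool
perfect E = allᵛ (Vec.map anyᵛ E) ∧ allᵛ (Vec.map anyᵛ (transpose E))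

valid : Pattern → Bool
valid E = allᵛ (Vec.map (λ row → countᵛ row ≤ᵇ 1) E) ∧ not (perfect E)

compatible : Pattern → Membership → Membership → Bool
compatible E a b =
  allᵛ (zipWith (λ row x → allᵛ (zipWith (λ e y → not (e ∧ (x xor y))) row b)) E a)
  ∧ (countᵛ a + countᵛ (zipWith (λ col y → not (anyᵛ col) ∧ y) (transpose E) b) ≤ᵇ 3)

avoidances : Pattern → Membership → Membership → Vec (Vec ℕ 3) 3
avoidances E a b = zipWith (λ row x → zipWith (λ e y → α e x y) row b) E a

score : Pattern → Membership → Membership → Membership → Membership → ℕ
score E a b a′ b′ = ∑ (toList (zipWith (zipWith _*_) (avoidances E a b) (avoidances E a′ b′))) (rowScore ∘ toList)

𝔹³ : Exhaustible Membership
𝔹³ = Vec-exhaustible Bool-exhaustible 3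

boundAt : Pattern → Membership → Membership → Membership → Membership → Bool
boundAt E a b a′ b′ = compatible E a′ b′ ⇒ (26 ≤ᵇ score E a b a′ b′)

boundAt-X : Pattern → Membership → Membership → Bool
boundAt-X E a b = compatible E a b ⇒ every² 𝔹³ (boundAt E a b)

boundAt-E : Pattern → Bool
boundAt-E E = valid E ⇒ every² 𝔹³ (boundAt-X E)

shadow-check : every (Vec-exhaustible 𝔹³ 3) boundAt-E ≡ true
shadow-check = refl

score-≥26 : ∀ E a b a′ b′ → T (valid E) → T (compatible E a b) → T (compatible E a′ b′)
          → 26 ≤ score E a b a′ b′
score-≥26 E a b a′ b′ valid-E compatible-ab compatible-a′b′ =
  ≤ᵇ⇒≤ 26 _ (Equivalence.from T-≡ (⇒-elim (every²-sound 𝔹³ (boundAt E a b) all-a′b′ a′ b′) (Equivalence.to T-≡ compatible-a′b′)))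
  where
  all-ab : every² 𝔹³ (boundAt-X E) ≡ true
  all-ab = ⇒-elim (every-sound (Vec-exhaustible 𝔹³ 3) boundAt-E shadow-check E) (Equivalence.to T-≡ valid-E)
  all-a′b′ : every² 𝔹³ (boundAt E a b) ≡ true
  all-a′b′ = ⇒-elim (every²-sound 𝔹³ (boundAt-X E) all-ab a b) (Equivalence.to T-≡ compatible-ab)

coincidences : Vec ℕ 3 → Vec ℕ 3 → Pattern
coincidences A B = Vec.map (λ c → Vec.map (c ≡ᵇ_) B) A

memberships : List ℕ → Vec ℕ 3 → Membership
memberships X = Vec.map (_∈ᵇ X)

∈⇒∈ᵇ : ∀ {c X} → c ∈ X → T (c ∈ᵇ X)
∈⇒∈ᵇ {c} c∈X = any⁺ (_≡ᵇ c) (Any.map (λ c≡x → ≡⇒≡ᵇ _ c (sym c≡x)) c∈X)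

any⇒∈ : ∀ {c} {p : ℕ → Bool} xs → (∀ {x} → T (p x) → c ≡ x) → T (any p xs) → c ∈ xs
any⇒∈ {p = p} xs p⇒≡ any-p = Any.map p⇒≡ (any⁻ p xs any-p)

covered⇒SameSet : ∀ {A B} → T (all (λ c → any (c ≡ᵇ_) B) A) → T (all (_∈ᵇ A) B) → SameSet A B
covered⇒SameSet {A} {B} A-covered B-covered =
  (λ c c∈A → any⇒∈ B (≡ᵇ⇒≡ c _) (All.lookup (all⁺ _ A A-covered) c∈A)) ,
  (λ d d∈B → any⇒∈ A (λ {x} x≡ᵇd → sym (≡ᵇ⇒≡ x d x≡ᵇd)) (All.lookup (all⁺ _ B B-covered) d∈B))

coincident-memberships : ∀ X c d → T (not ((c ≡ᵇ d) ∧ ((c ∈ᵇ X) xor (d ∈ᵇ X))))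
coincident-memberships X c d with c ≟ d
... | yes refl rewrite xor-same (c ∈ᵇ X) | ∧-zeroʳ (c ≡ᵇ c) = _
... | no c≢d rewrite dec-false (c ≟ d) c≢d = _

∑-∈ᵇ-≤ : ∀ X {ps} → Unique ps → ∑ ps (λ p → 𝟙 (p ∈ᵇ X)) ≤ length X
∑-∈ᵇ-≤ []      {ps} _  = ≤-reflexive (∑-zero ps)
∑-∈ᵇ-≤ (x ∷ X) {ps} uP = begin
  ∑ ps (λ p → 𝟙 ((x ≡ᵇ p) ∨ (p ∈ᵇ X)))               ≤⟨ ∑-mono ps (λ p → 𝟙-∨-≤ (x ≡ᵇ p) (p ∈ᵇ X)) ⟩
  ∑ ps (λ p → 𝟙 (x ≡ᵇ p) + 𝟙 (p ∈ᵇ X))               ≡⟨ ∑-+ ps _ _ ⟩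
  ∑ ps (λ p → 𝟙 (x ≡ᵇ p)) + ∑ ps (λ p → 𝟙 (p ∈ᵇ X))  ≤⟨ +-mono-≤ (≤-trans (≤-reflexive (∑-𝟙-≡ᵇ x uP)) (𝟙≤1 _)) (∑-∈ᵇ-≤ X uP) ⟩
  suc (length X)                                     ∎
  where
  open ≤-Reasoning
  𝟙-∨-≤ : ∀ u v → 𝟙 (u ∨ v) ≤ 𝟙 u + 𝟙 v
  𝟙-∨-≤ true  v = s≤s z≤n
  𝟙-∨-≤ false v = ≤-refl

∑-∈ᵇ-union-≤ : ∀ X {A B} → Unique A → Unique B
             → ∑ A (λ c → 𝟙 (c ∈ᵇ X)) + ∑ B (λ d → 𝟙 (not (d ∈ᵇ A) ∧ (d ∈ᵇ X))) ≤ length X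
∑-∈ᵇ-union-≤ X {A} {B} uA uB = begin
  ∑ A (λ c → 𝟙 (c ∈ᵇ X)) + ∑ B (λ d → 𝟙 (fresh d ∧ (d ∈ᵇ X)))    ≡⟨ cong (∑ A (λ c → 𝟙 (c ∈ᵇ X)) +_) (∑-filterᵇ fresh (_∈ᵇ X) B) ⟨
  ∑ A (λ c → 𝟙 (c ∈ᵇ X)) + ∑ (filterᵇ fresh B) (λ d → 𝟙 (d ∈ᵇ X)) ≡⟨ ∑-++ A (filterᵇ fresh B) _ ⟨
  ∑ (A ++ filterᵇ fresh B) (λ p → 𝟙 (p ∈ᵇ X))                       ≤⟨ ∑-∈ᵇ-≤ X (Unique.++⁺ uA (Unique.filter⁺ (T? ∘ fresh) uB) disjoint) ⟩
  length X                                                          ∎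
  where
  open ≤-Reasoning
  fresh : ℕ → Bool
  fresh d = not (d ∈ᵇ A)
  not-both : ∀ b → T b → T (not b) → ⊥
  not-both true _ ()
  disjoint : ∀ {c} → c ∈ A × c ∈ filterᵇ fresh B → ⊥
  disjoint {c} (c∈A , c∈F) = not-both (c ∈ᵇ A) (∈⇒∈ᵇ c∈A) (proj₂ (∈-filter⁻ (T? ∘ fresh) {xs = B} c∈F))

triple-shape : ∀ {X : List ℕ} → length X ≡ 3 → ∃[ x ] ∃[ y ] ∃[ z ] X ≡ x ∷ y ∷ z ∷ []
triple-shape {x ∷ y ∷ z ∷ []} refl = x , y , z , refl

T-not-intro : ∀ {x} → ¬ T x → T (not x)
T-not-intro {false} _  = _
T-not-intro {true}  ¬t = ¬t _

-- Once A and B are explicit triples, the Boolean conditions on their shadows unfold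
-- definitionally to the list expressions established in valid-E and compatible-E.
rowScores-≥26 : ∀ {A B X Y} → Triple A → Triple B → Triple X → Triple Y → ¬ SameSet A B
              → 26 ≤ ∑ A (λ c → rowScore (map (λ d → avoid X c d * avoid Y c d) B))
rowScores-≥26 {A} {B} {X} {Y} (uA , |A|≡3) (uB , |B|≡3) tX tY A≉B
  with triple-shape {A} |A|≡3 | triple-shape {B} |B|≡3
... | c₀ , c₁ , c₂ , refl | d₀ , d₁ , d₂ , refl =
  subst (26 ≤_) (∑-cong A λ c → cong rowScore (map-cong (λ d → cong₂ _*_ (sym (avoid-α c d tX)) (sym (avoid-α c d tY))) B))
    (score-≥26 E (memberships X A⃗) (memberships X B⃗) (memberships Y A⃗) (memberships Y B⃗)
       valid-E (compatible-E tX) (compatible-E tY))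
  where
  A⃗ B⃗ : Vec ℕ 3
  A⃗ = c₀ ∷ c₁ ∷ c₂ ∷ []
  B⃗ = d₀ ∷ d₁ ∷ d₂ ∷ []
  E : Pattern
  E = coincidences A⃗ B⃗
  valid-E : T (valid E)
  valid-E = Equivalence.from (T-∧ {all (λ c → ∑ B (λ d → 𝟙 (c ≡ᵇ d)) ≤ᵇ 1) A})
    ( all⁻ _ (All.universal (λ c → ≤⇒≤ᵇ (≤-trans (≤-reflexive (∑-𝟙-≡ᵇ c uB)) (𝟙≤1 _))) A)
    , T-not-intro λ perfect-E →
        let covered = Equivalence.to (T-∧ {all (λ c → any (c ≡ᵇ_) B) A}) perfect-E
        in A≉B (covered⇒SameSet (proj₁ covered) (proj₂ covered)))
  compatible-E : ∀ {Z} → Triple Z → T (compatible E (memberships Z A⃗) (memberships Z B⃗))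
  compatible-E {Z} (_ , |Z|≡3) =
    Equivalence.from (T-∧ {all (λ c → all (λ d → not ((c ≡ᵇ d) ∧ ((c ∈ᵇ Z) xor (d ∈ᵇ Z)))) B) A})
      ( all⁻ _ (All.universal (λ c → all⁻ _ (All.universal (coincident-memberships Z c) B)) A)
      , ≤⇒≤ᵇ (≤-trans (∑-∈ᵇ-union-≤ Z uA uB) (≤-reflexive |Z|≡3)))

P-Θ₂₂-≥ : ∀ j L → IsAssignment 3 (Theta 2 2 (4 + j)) L → ¬ SameSet (L θu) (L θv)
        → 26 * 2 ^ (2 + j) ≤ P (Theta 2 2 (4 + j)) L
P-Θ₂₂-≥ j L isA L₀≉L₁ = begin
  26 * q                                                ≤⟨ *-monoˡ-≤ q (rowScores-≥26 (triple 0) (triple 1) (triple 2) (triple 3) L₀≉L₁) ⟩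
  ∑ (L 0) (λ c → rowScore (map (w c) (L 1))) * q        ≡⟨ *-comm _ q ⟩
  q * ∑ (L 0) (λ c → rowScore (map (w c) (L 1)))        ≤⟨ ∑-rowScore-≤ (L 0) (L 1) w N (λ c d → walks-≥ L 4 (2 + j) c d isA) ∑N-≥ ⟩
  ∑ (L 0) (λ c → ∑ (L 1) (λ d → w c d * N c d))         ≡⟨ P-Θ₂₂ (4 + j) L ⟨
  P (Theta 2 2 (4 + j)) L                               ∎
  where
  open ≤-Reasoning
  q = 2 ^ (2 + j)
  w N : ℕ → ℕ → ℕ
  w c d = avoid (L 2) c d * avoid (L 3) c d
  N = walks L 4 (3 + j)
  triple : ∀ i → {True (i <? 4)} → Triple (L i)
  triple i {i<4} = isA i (≤-trans (toWitness i<4) (m≤m+n 4 (3 + j)))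
  ∑N-≥ : ∀ c → suc (length (L 1)) * q ≤ ∑ (L 1) (N c)
  ∑N-≥ c rewrite proj₂ (triple 1) =
    subst (_≤ ∑ (L 1) (N c)) (sym (*-assoc 2 2 q)) (∑-walks-≥ L 4 (3 + j) c (triple 1) isA)

-- Three colours

K₃ : ListAssignment
K₃ _ = upTo 3

eqWalks neWalks : ℕ → ℕ
eqWalks zero    = 0
eqWalks (suc m) = neWalks m + neWalks m
neWalks zero    = 1
neWalks (suc m) = eqWalks m + neWalks m

-- For a, b < 3 the sum below unfolds to x + 0 + (y + 0 + 0), x and y being its two
-- non-zero terms.
unpad : ∀ x y → x + 0 + (y + 0 + 0) ≡ x + y
unpad = solve-∀

walks-K₃-step : ∀ s t a b → a < 3 → b < 3
              → ∑ (upTo 3) (λ z → neq a z * (if z ≡ᵇ b then s else t)) ≡ (if a ≡ᵇ b then t + t else s + t)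
walks-K₃-step s t 0 0 _ _ = unpad t t
walks-K₃-step s t 0 1 _ _ = unpad s t
walks-K₃-step s t 0 2 _ _ = trans (unpad t s) (+-comm t s)
walks-K₃-step s t 1 0 _ _ = unpad s t
walks-K₃-step s t 1 1 _ _ = unpad t t
walks-K₃-step s t 1 2 _ _ = trans (unpad t s) (+-comm t s)
walks-K₃-step s t 2 0 _ _ = unpad s t
walks-K₃-step s t 2 1 _ _ = trans (unpad t s) (+-comm t s)
walks-K₃-step s t 2 2 _ _ = unpad t t
walks-K₃-step s t (suc (suc (suc _))) _ (s≤s (s≤s (s≤s ()))) _
walks-K₃-step s t a (suc (suc (suc _))) _ (s≤s (s≤s (s≤s ())))

walks-K₃ : ∀ m i a b → a < 3 → b < 3 → walks K₃ i m a b ≡ (if a ≡ᵇ b then eqWalks m else neWalks m)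
walks-K₃ zero    i a b _   _   with a ≡ᵇ b
... | true  = refl
... | false = refl
walks-K₃ (suc m) i a b a<3 b<3 = trans
  (∑-cong-∈ (upTo 3) (λ z z∈ → cong (neq a z *_) (walks-K₃ m (suc i) z b (∈-upTo⁻ z∈) b<3)))
  (walks-K₃-step (eqWalks m) (neWalks m) a b a<3 b<3)

Pchrom-Θ₂₂ : ∀ n → Pchrom (Theta 2 2 n) 3 ≡ 12 * eqWalks (n ∸ 1) + 6 * neWalks (n ∸ 1)
Pchrom-Θ₂₂ n = trans (P-Θ₂₂ n K₃) (trans
  (∑-cong-∈ (upTo 3) λ c c∈ → ∑-cong-∈ (upTo 3) λ d d∈ →
    cong (avoid (upTo 3) c d * avoid (upTo 3) c d *_) (walks-K₃ (n ∸ 1) 4 c d (∈-upTo⁻ c∈) (∈-upTo⁻ d∈)))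
  (tally (eqWalks (n ∸ 1)) (neWalks (n ∸ 1))))
  where
  -- the unfolded 3 × 3 sum: weight 2 · 2 on the diagonal, 1 · 1 off it
  tally : ∀ s t → (4 * s + (1 * t + (1 * t + 0))) + ((1 * t + (4 * s + (1 * t + 0))) + ((1 * t + (1 * t + (4 * s + 0))) + 0))
                ≡ 12 * s + 6 * t
  tally = solve-∀

eqWalks+2neWalks : ∀ m → eqWalks m + 2 * neWalks m ≡ 2 ^ suc m
eqWalks+2neWalks zero    = refl
eqWalks+2neWalks (suc m) = trans (double (eqWalks m) (neWalks m)) (cong (2 *_) (eqWalks+2neWalks m))
  where
  double : ∀ s t → t + t + 2 * (s + t) ≡ 2 * (s + 2 * t)
  double = solve-∀

walks-balanced : ∀ m → eqWalks m ≤ suc (neWalks m) × neWalks m ≤ suc (eqWalks m)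
walks-balanced zero    = z≤n , s≤s z≤n
walks-balanced (suc m) =
  +-monoˡ-≤ (neWalks m) (proj₂ (walks-balanced m)) , +-monoˡ-≤ (neWalks m) (proj₁ (walks-balanced m))

Pchrom-Θ₂₂-≤ : ∀ j → Pchrom (Theta 2 2 (4 + j)) 3 ≤ 26 * 2 ^ (2 + j)
Pchrom-Θ₂₂-≤ j = begin
  Pchrom (Theta 2 2 (4 + j)) 3        ≡⟨ Pchrom-Θ₂₂ (4 + j) ⟩
  12 * s + 6 * t                      ≡⟨ split s t ⟩
  6 * s + 6 * t + 6 * s               ≤⟨ +-monoʳ-≤ (6 * s + 6 * t) (*-monoʳ-≤ 6 (proj₁ (walks-balanced (3 + j)))) ⟩
  6 * s + 6 * t + 6 * suc t           ≡⟨ merge s t ⟩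
  6 * (s + 2 * t) + 6                 ≡⟨ cong (λ x → 6 * x + 6) (eqWalks+2neWalks (3 + j)) ⟩
  6 * (2 * (2 * q)) + 6               ≤⟨ +-monoʳ-≤ (6 * (2 * (2 * q))) (*-monoʳ-≤ 2 (≤-trans (s≤s (s≤s (s≤s z≤n))) 4≤q)) ⟩
  6 * (2 * (2 * q)) + 2 * q           ≡⟨ total q ⟩
  26 * q                              ∎
  where
  open ≤-Reasoning
  s = eqWalks (3 + j)
  t = neWalks (3 + j)
  q = 2 ^ (2 + j)
  4≤q : 4 ≤ q
  4≤q = ^-monoʳ-≤ 2 (m≤m+n 2 j)
  split : ∀ s t → 12 * s + 6 * t ≡ 6 * s + 6 * t + 6 * s
  split = solve-∀
  merge : ∀ s t → 6 * s + 6 * t + 6 * suc t ≡ 6 * (s + 2 * t) + 6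
  merge = solve-∀
  total : ∀ q → 6 * (2 * (2 * q)) + 2 * q ≡ 26 * q
  total = solve-∀

Pchrom≤P-Θ₂₂ : ∀ n → 4 ≤ n → (L : ListAssignment) → IsAssignment 3 (Theta 2 2 n) L
             → ¬ SameSet (L θu) (L θv) → Pchrom (Theta 2 2 n) 3 ≤ P (Theta 2 2 n) L
Pchrom≤P-Θ₂₂ _ (s≤s (s≤s (s≤s (s≤s (z≤n {j}))))) L isA L₀≉L₁ =
  ≤-trans (Pchrom-Θ₂₂-≤ j) (P-Θ₂₂-≥ j L isA L₀≉L₁)

mainTheorem12 : (k : ℕ) → 2 ≤ k → (L : ListAssignment)
    → IsAssignment 3 (Theta 2 2 (2 * k)) L
    → ¬ SameSet (L θu) (L θv)
    → Pchrom (Theta 2 2 (2 * k)) 3 ≤ P (Theta 2 2 (2 * k)) L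
mainTheorem12 k 2≤k = Pchrom≤P-Θ₂₂ (2 * k) (*-monoʳ-≤ 2 2≤k)
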